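{- For any integer $t \geq 3$ and any $\epsilon > 0$, there exists a positive integer $n$ with exactly $t$ distinct prime factors such that $\frac{i(X_n)}{n/p_t} < \epsilon$, where $p_t$ is the largest prime divisor of $n$.
   Context: $X_n$ is the graph on $\{0,\dots,n-1\}$ with $a,b$ adjacent iff $\gcd(a-b,n)=1$. $i(G)$ is the minimum size of a maximal independent set of $G$.
   Formalization: The parameter ε ranges over the positive rationals. -}

module Defs where

open import Data.Nat using (ℕ; _≤_; _<_)
open import Data.Nat.Base using (∣_-_∣)
open import Data.Nat.GCD using (gcd)
open import Data.Nat.Divisibility using (_∣_)
open import Data.Nat.Primality using (Prime)
open import Data.Fin using (Fin; toℕ)
open import Data.Fin.Subset using (Subset; _∈_; _∉_; ∣_∣)
open import Data.List using (List; length)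
open import Data.List.Relation.Unary.Unique.Propositional using (Unique)
import Data.List.Membership.Propositional as LM
open import Data.Product using (Σ; _×_; ∃)
open import Relation.Binary.PropositionalEquality using (_≡_; _≢_)
open import Relation.Nullary using (¬_)

-- The unitary Cayley graph X_n on {0,...,n-1}: a ~ b iff gcd(a-b, n) = 1.
-- (Loops a ~ a only occur for n = 1; we require a ≢ b, i.e. simple graph.)
Adj : (n : ℕ) → Fin n → Fin n → Set
Adj n a b = (a ≢ b) × (gcd ∣ toℕ a - toℕ b ∣ n ≡ 1)

Independent : (n : ℕ) → Subset n → Set
Independent n S = ∀ a b → a ∈ S → b ∈ S → ¬ Adj n a b

MaximalIndependent : (n : ℕ) → Subset n → Set
MaximalIndependent n S =
  Independent n S × (∀ v → v ∉ S → Σ (Fin n) λ u → u ∈ S × Adj n v u)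

IsIndepDomNumber : (n : ℕ) → ℕ → Set
IsIndepDomNumber n k =
  (Σ (Subset n) λ S → MaximalIndependent n S × ∣ S ∣ ≡ k) ×
  (∀ S → MaximalIndependent n S → k ≤ ∣ S ∣)

HasExactlyPrimeFactors : ℕ → ℕ → Set
HasExactlyPrimeFactors n t =
  Σ (List ℕ) λ ps → Unique ps × length ps ≡ t ×
    (∀ p → (p LM.∈ ps → Prime p × p ∣ n) × (Prime p → p ∣ n → p LM.∈ ps))

IsLargestPrimeDivisor : ℕ → ℕ → Set
IsLargestPrimeDivisor p n = Prime p × p ∣ n × (∀ q → Prime q → q ∣ n → q ≤ p)

module Submission where

-- Corollary 4.11 (unitary Cayley graphs X_n): for t ≥ 3 and any ε = a / b > 0 there is n with
-- exactly t prime factors and largest prime factor p such that i(X_n) / (n / p) < ε, in the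
-- integral form  i(X_n) · p · b < a · n.
--
-- Take n = P₁ P₂ P₃ R, where R is a product of t − 3 distinct primes and R < P₁ < P₂ < P₃
-- are primes with P₁ > 4b; put M = P₁ P₂ P₃.  For each codeword c of the even-weight code
-- {(x, y, x ⊕ y)} ⊆ {0,1}³ choose a number g c whose residue modulo P_k takes one of two
-- fixed values according to the bit c_k, and let S be the set of x < n with x ≡ g c (mod M)
-- for some c.
--  * Two codewords agree in some coordinate k, so members of S are congruent modulo P_k and
--    never adjacent: S is independent.
--  * A vertex v ∉ S differs from some codeword c in every coordinate (covering property);
--    shifting g c by a multiple of M so as to avoid v's residues modulo the primes of R
--    (avoid-residues) yields a member of S adjacent to v: S is maximal.
--  * S meets every block of M consecutive numbers in at most 4 points, so |S| ≤ 4R.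
-- Hence i(X_n) ≤ 4R = 4n/M, and i(X_n) · P₃ · b ≤ 4 R P₃ b < a n because 4b < P₁ ≤ a P₁ P₂.

open import Data.Bool using (Bool; true; false; not; _∨_; _xor_; T)
import Data.Bool as Bool
open import Data.Bool.Properties using (T-≡; not-¬; ¬-not; xor-assoc; xor-same; xor-identityʳ; xor-annihilates-not)
open import Data.Fin using (Fin; toℕ; fromℕ<)
import Data.Fin.Properties as Fin
open import Data.Fin.Properties using (toℕ-fromℕ<)
open import Data.Fin.Subset using (Subset; _∈_; _∉_; ∣_∣)
open import Data.Fin.Subset.Properties using (_∈?_; anySubset?)
open import Data.List using (List; []; _∷_; _++_; length)
open import Data.Bool.ListAction using (any)
open import Data.List.Relation.Unary.All as All using (All; []; _∷_)
open import Data.List.Relation.Unary.AllPairs using ([]; _∷_)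
open import Data.List.Relation.Unary.Unique.Propositional using (Unique)
open import Data.Maybe using (Maybe; just; nothing)
open import Data.Maybe.Properties using (just-injective)
open import Data.Nat
open import Data.Nat.Properties
open import Data.Nat.Solver using (module +-*-Solver)
open import Data.Nat.DivMod
open import Data.Nat.Divisibility
open import Data.Nat.Primality
open import Data.Nat.Coprimality using (Coprime; gcd≡1⇒coprime; coprime⇒gcd≡1)
open import Data.Nat.GCD using (gcd)
open import Data.Nat.Primality.Factorisation using (factorise; factorisationHasAllPrimeFactors)
open import Data.Nat.ListAction using (product)
open import Data.Nat.ListAction.Properties using (∈⇒∣product; ∈⇒≤product; product-++)
open import Data.List.Relation.Unary.Any as Any using (here; there)
open import Data.List.Relation.Unary.Any.Properties using (any⁺; any⁻)
import Data.List.Membership.Propositional as LM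
open import Data.Product using (Σ; _×_; _,_; proj₁; proj₂)
open import Data.Sum using (_⊎_; inj₁; inj₂; [_,_])
open import Data.Empty using (⊥; ⊥-elim)
open import Data.Vec using (tabulate)
open import Data.Vec.Properties using (lookup∘tabulate; lookup⇒[]=; []=⇒lookup)
open import Function using (_∘_; Equivalence)
open import Relation.Binary.PropositionalEquality
  using (_≡_; _≢_; refl; sym; trans; cong; cong₂; subst; module ≡-Reasoning)
open import Relation.Nullary using (¬_; yes; no; Dec)
open import Relation.Nullary.Decidable using (_×-dec_; _→-dec_; ¬?)
open import Relation.Nullary.Negation using (contradiction)
open import Relation.Unary using (Decidable)

open import Algebra.Properties.CommutativeSemigroup +-commutativeSemigroup
  using () renaming (interchange to +-interchange)

open import Defs

infix 4 _≡_modulo_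
_≡_modulo_ : ℕ → ℕ → ℕ → Set
_≡_modulo_ a b q = q ∣ ∣ a - b ∣

≡modulo-sym : ∀ {a b q} → a ≡ b modulo q → b ≡ a modulo q
≡modulo-sym {a} {b} {q} = subst (q ∣_) (∣-∣-comm a b)

%≡%⇒≡modulo : ∀ a b q .{{_ : NonZero q}} → a % q ≡ b % q → a ≡ b modulo q
%≡%⇒≡modulo a b q eq = divides ∣ a / q - b / q ∣ (begin
  ∣ a - b ∣                                   ≡⟨ cong₂ ∣_-_∣ (m≡m%n+[m/n]*n a q) (m≡m%n+[m/n]*n b q) ⟩
  ∣ a % q + a / q * q - b % q + b / q * q ∣   ≡⟨ cong (λ r → ∣ a % q + a / q * q - r + b / q * q ∣) (sym eq) ⟩
  ∣ a % q + a / q * q - a % q + b / q * q ∣   ≡⟨ ∣m+n-m+o∣≡∣n-o∣ (a % q) (a / q * q) (b / q * q) ⟩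
  ∣ a / q * q - b / q * q ∣                   ≡⟨ *-distribʳ-∣-∣ q (a / q) (b / q) ⟨
  ∣ a / q - b / q ∣ * q                       ∎)
  where open ≡-Reasoning

%-upper≡%-lower : ∀ {x y q} .{{_ : NonZero q}} → x ≤ y → q ∣ y ∸ x → y % q ≡ x % q
%-upper≡%-lower {x} {q = q} x≤y q∣y∸x =
  trans (cong (_% q) (sym (m+[n∸m]≡n x≤y))) (%-remove-+ʳ x q∣y∸x)

≡modulo⇒%≡% : ∀ a b q .{{_ : NonZero q}} → a ≡ b modulo q → a % q ≡ b % q
≡modulo⇒%≡% a b q a≡b with ≤-total a b
... | inj₁ a≤b = sym (%-upper≡%-lower a≤b (subst (q ∣_) (m≤n⇒∣m-n∣≡n∸m a≤b) a≡b))
... | inj₂ b≤a = %-upper≡%-lower b≤a (subst (q ∣_) (m≤n⇒∣m-n∣≡n∸m b≤a) (≡modulo-sym {a} a≡b))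

shift≡modulo⇒∣ : ∀ c d q → c + d ≡ c modulo q → q ∣ d
shift≡modulo⇒∣ c d q = subst (q ∣_) (trans (∣-∣-comm (c + d) c) (∣m-m+n∣≡n c d))

≡modulo-trans : ∀ {a b c q} .{{_ : NonZero q}} → a ≡ b modulo q → b ≡ c modulo q → a ≡ c modulo q
≡modulo-trans {a} {b} {c} {q} a≡b b≡c =
  %≡%⇒≡modulo a c q (trans (≡modulo⇒%≡% a b q a≡b) (≡modulo⇒%≡% b c q b≡c))

%-reduce : ∀ {x y d m} .{{_ : NonZero d}} .{{_ : NonZero m}} → d ∣ m → x % m ≡ y % m → x % d ≡ y % d
%-reduce {x} {y} {d} {m} d∣m eq = begin
  x % d     ≡⟨ m∣n⇒o%n%m≡o%m d m x d∣m ⟨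
  x % m % d ≡⟨ cong (_% d) eq ⟩
  y % m % d ≡⟨ m∣n⇒o%n%m≡o%m d m y d∣m ⟩
  y % d     ∎
  where open ≡-Reasoning

prime>1 : ∀ {p} → Prime p → 1 < p
prime>1 {p} p-prime = nonTrivial⇒n>1 p {{prime⇒nonTrivial p-prime}}

prime-divisor : ∀ m → 1 < m → Σ ℕ λ p → Prime p × p ∣ m
prime-divisor m 1<m with factorise m {{>-nonZero (<-trans z<s 1<m)}}
... | record { factors = [] ; isFactorisation = m≡1 } = contradiction m≡1 (>⇒≢ 1<m)
... | record { factors = p ∷ ps ; isFactorisation = eq ; factorsPrime = p-prime ∷ _ } =
  p , p-prime , subst (p ∣_) (sym eq) (∈⇒∣product {ns = p ∷ ps} (here refl))

∣-factorial : ∀ {d m} → 0 < d → d ≤ m → d ∣ m !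
∣-factorial {suc d} _ d≤m = ∣-trans (m∣m*n (d !)) (m≤n⇒m!∣n! d≤m)

-- Euclid: a prime divisor of m ! + 1 exceeds m, so there are primes above every bound.
-- (Opaque: only its specification matters, and unfolding the search slows unification.)
opaque
  prime-above : ∀ m → Σ ℕ λ p → Prime p × m < p
  prime-above m with prime-divisor (m ! + 1) (+-monoˡ-≤ 1 (>-nonZero⁻¹ (m !) {{m !≢0}}))
  ... | p , p-prime , p∣m!+1 with m <? p
  ... | yes m<p = p , p-prime , m<p
  ... | no m≮p = contradiction (∣1⇒≡1 (∣m+n∣m⇒∣n p∣m!+1 p∣m!)) (>⇒≢ (prime>1 p-prime))
    where
    p∣m! : p ∣ m !
    p∣m! = ∣-factorial (<-trans z<s (prime>1 p-prime)) (≮⇒≥ m≮p)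

prime∤prime : ∀ {p q} → Prime p → Prime q → p ≢ q → ¬ p ∣ q
prime∤prime p-prime q-prime p≢q p∣q with prime⇒irreducible q-prime p∣q
... | inj₁ p≡1 = >⇒≢ (prime>1 p-prime) p≡1
... | inj₂ p≡q = p≢q p≡q

prime∤* : ∀ {p m n} → Prime p → ¬ p ∣ m → ¬ p ∣ n → ¬ p ∣ m * n
prime∤* {m = m} {n} p-prime p∤m p∤n p∣mn with euclidsLemma m n p-prime p∣mn
... | inj₁ p∣m = p∤m p∣m
... | inj₂ p∣n = p∤n p∣n

∣-extend-prime : ∀ {p m d} → Prime p → ¬ p ∣ m → m ∣ d → p ∣ d → m * p ∣ d
∣-extend-prime {p} {m} p-prime p∤m (divides k refl) p∣km with euclidsLemma k m p-prime p∣km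
... | inj₂ p∣m = contradiction p∣m p∤m
... | inj₁ (divides l refl) = divides l (trans (*-assoc l p m) (cong (l *_) (*-comm p m)))

product-∣ : ∀ {ps d} → All Prime ps → Unique ps → All (_∣ d) ps → product ps ∣ d
product-∣ {d = d} []  [] [] = 1∣ d
product-∣ {p ∷ ps} {d} (p-prime ∷ ps-prime) (p∉ps ∷ ps-unique) (p∣d ∷ ps∣d) =
  subst (_∣ d) (*-comm (product ps) p)
    (∣-extend-prime p-prime p∤Π (product-∣ ps-prime ps-unique ps∣d) p∣d)
  where
  p∤Π : ¬ p ∣ product ps
  p∤Π p∣Π = All.lookup p∉ps (factorisationHasAllPrimeFactors p-prime p∣Π ps-prime) refl

no-common-prime⇒coprime : ∀ {m n} .{{_ : NonZero n}} →
  (∀ p → Prime p → p ∣ m → p ∣ n → ⊥) → Coprime m n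
no-common-prime⇒coprime {n = n} none {zero} (_ , 0∣n) = contradiction (0∣⇒≡0 0∣n) (≢-nonZero⁻¹ n)
no-common-prime⇒coprime none {1} _ = refl
no-common-prime⇒coprime none {d@(suc (suc _))} (d∣m , d∣n) with prime-divisor d (s≤s (s≤s z≤n))
... | p , p-prime , p∣d = ⊥-elim (none p p-prime (∣-trans p∣d d∣m) (∣-trans p∣d d∣n))

escape : ∀ {q} .{{_ : NonZero q}} K → ¬ q ∣ K → ∀ c v →
  Σ ℕ λ s → ¬ c + K * s ≡ v modulo q
escape {q} K q∤K c v with q ∣? ∣ c - v ∣
... | no c≢v = 0 , subst (λ x → ¬ x ≡ v modulo q) c≡c+K*0 c≢v
  where
  c≡c+K*0 : c ≡ c + K * 0
  c≡c+K*0 = sym (trans (cong (c +_) (*-zeroʳ K)) (+-identityʳ c))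
... | yes c≡v = 1 , q∤K ∘ q∣K
  where
  -- c + K and c are both congruent to v, hence to each other
  q∣K : c + K * 1 ≡ v modulo q → q ∣ K
  q∣K c+K≡v = subst (q ∣_) (*-identityʳ K)
    (shift≡modulo⇒∣ c (K * 1) q (≡modulo-trans {c + K * 1} {v} {c} c+K≡v (≡modulo-sym {c} c≡v)))

-- The first prime is handled by
-- escape; the step is then multiplied by q, so later shifts keep the residue modulo q.
avoid-residues : (qs : List ℕ) → All Prime qs → Unique qs →
  ∀ K → All (λ q → ¬ q ∣ K) qs → ∀ c v →
  Σ ℕ λ y → All (λ q → ¬ c + K * y ≡ v modulo q) qs
avoid-residues [] _ _ K _ c v = 0 , []
avoid-residues (q ∷ qs) (q-prime ∷ qs-prime) (q∉qs ∷ qs-unique) K (q∤K ∷ qs∤K) c v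
  with escape {{prime⇒nonZero q-prime}} K q∤K c v
... | s , c′≢v with avoid-residues qs qs-prime qs-unique (K * q) qs∤Kq (c + K * s) v
  where
  qs∤Kq : All (λ r → ¬ r ∣ K * q) qs
  qs∤Kq = All.zipWith r∤Kq (qs-prime , All.zip (q∉qs , qs∤K))
    where
    r∤Kq : ∀ {r} → Prime r × q ≢ r × ¬ r ∣ K → ¬ r ∣ K * q
    r∤Kq (r-prime , q≢r , r∤K) = prime∤* r-prime r∤K (prime∤prime r-prime q-prime (q≢r ∘ sym))
... | y , avoids = s + q * y , q-avoided ∷ All.map (λ {r} → subst (λ x → ¬ x ≡ v modulo r) regroup) avoids
  where
  instance _ = prime⇒nonZero q-prime
  regroup : c + K * s + K * q * y ≡ c + K * (s + q * y)
  regroup = begin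
    c + K * s + K * q * y   ≡⟨ +-assoc c (K * s) (K * q * y) ⟩
    c + (K * s + K * q * y) ≡⟨ cong (λ x → c + (K * s + x)) (*-assoc K q y) ⟩
    c + (K * s + K * (q * y)) ≡⟨ cong (c +_) (*-distribˡ-+ K s (q * y)) ⟨
    c + K * (s + q * y)     ∎
    where open ≡-Reasoning
  q-avoided : ¬ c + K * (s + q * y) ≡ v modulo q
  q-avoided c″≡v = c′≢v (%≡%⇒≡modulo (c + K * s) v q (begin
    (c + K * s) % q             ≡⟨ %-remove-+ʳ (c + K * s) (∣m⇒∣m*n y (n∣m*n K)) ⟨
    (c + K * s + K * q * y) % q ≡⟨ cong (_% q) regroup ⟩
    (c + K * (s + q * y)) % q   ≡⟨ ≡modulo⇒%≡% _ v q c″≡v ⟩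
    v % q                       ∎))
    where open ≡-Reasoning

indicator : Bool → ℕ
indicator true  = 1
indicator false = 0

count : (ℕ → Bool) → ℕ → ℕ
count f zero    = 0
count f (suc m) = indicator (f 0) + count (f ∘ suc) m

count-cong : ∀ {f g} m → (∀ x → f x ≡ g x) → count f m ≡ count g m
count-cong zero    f≗g = refl
count-cong (suc m) f≗g = cong₂ _+_ (cong indicator (f≗g 0)) (count-cong m (f≗g ∘ suc))

count-+ : ∀ f m o → count f (m + o) ≡ count f m + count (λ x → f (m + x)) o
count-+ f zero    o = refl
count-+ f (suc m) o = trans (cong (indicator (f 0) +_) (count-+ (f ∘ suc) m o))
                            (sym (+-assoc (indicator (f 0)) _ _))

count-periodic : ∀ f M → (∀ x → f (M + x) ≡ f x) → ∀ j → count f (j * M) ≡ j * count f M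
count-periodic f M periodic zero    = refl
count-periodic f M periodic (suc j) = begin
  count f (M + j * M)                         ≡⟨ count-+ f M (j * M) ⟩
  count f M + count (λ x → f (M + x)) (j * M) ≡⟨ cong (count f M +_) (count-cong (j * M) periodic) ⟩
  count f M + count f (j * M)                 ≡⟨ cong (count f M +_) (count-periodic f M periodic j) ⟩
  count f M + j * count f M                   ∎
  where open ≡-Reasoning

count-mono : ∀ {f g} m → (∀ x → x < m → T (f x) → T (g x)) → count f m ≤ count g m
count-mono {f} {g} zero    f⇒g = z≤n
count-mono {f} {g} (suc m) f⇒g =
  +-mono-≤ (indicator-mono (f⇒g 0 z<s)) (count-mono m (λ x x<m → f⇒g (suc x) (s≤s x<m)))
  where
  indicator-mono : ∀ {a b} → (T a → T b) → indicator a ≤ indicator b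
  indicator-mono {false}          _   = z≤n
  indicator-mono {true}  {true}   _   = ≤-refl
  indicator-mono {true}  {false} a⇒b = ⊥-elim (a⇒b _)

count-∨ : ∀ f g m → count (λ x → f x ∨ g x) m ≤ count f m + count g m
count-∨ f g zero    = z≤n
count-∨ f g (suc m) = begin
  indicator (f 0 ∨ g 0) + count (λ x → f (suc x) ∨ g (suc x)) m
    ≤⟨ +-mono-≤ (indicator-∨ (f 0) (g 0)) (count-∨ (f ∘ suc) (g ∘ suc) m) ⟩
  (indicator (f 0) + indicator (g 0)) + (count (f ∘ suc) m + count (g ∘ suc) m)
    ≡⟨ +-interchange (indicator (f 0)) (indicator (g 0)) _ _ ⟩
  indicator (f 0) + count (f ∘ suc) m + (indicator (g 0) + count (g ∘ suc) m) ∎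
  where
  open ≤-Reasoning
  indicator-∨ : ∀ a b → indicator (a ∨ b) ≤ indicator a + indicator b
  indicator-∨ true  b = s≤s z≤n
  indicator-∨ false b = ≤-refl

count-never : ∀ m → count (λ _ → false) m ≡ 0
count-never zero    = refl
count-never (suc m) = count-never m

count-≡ᵇ : ∀ r m → count (_≡ᵇ r) m ≤ 1
count-≡ᵇ r       zero    = z≤n
count-≡ᵇ zero    (suc m) = ≤-reflexive (cong suc (count-never m))
count-≡ᵇ (suc r) (suc m) = count-≡ᵇ r m

count-targets : ∀ {A : Set} (h : A → ℕ) (cs : List A) m →
  count (λ x → any (λ c → x ≡ᵇ h c) cs) m ≤ length cs
count-targets h []       m = ≤-reflexive (count-never m)
count-targets h (c ∷ cs) m = ≤-trans (count-∨ (_≡ᵇ h c) _ m) (+-mono-≤ (count-≡ᵇ (h c) m) (count-targets h cs m))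

subsetOf : (ℕ → Bool) → (n : ℕ) → Subset n
subsetOf f n = tabulate (f ∘ toℕ)

∈-subsetOf⁺ : ∀ {f n} (i : Fin n) → T (f (toℕ i)) → i ∈ subsetOf f n
∈-subsetOf⁺ {f} i fi = lookup⇒[]= i _ (trans (lookup∘tabulate (f ∘ toℕ) i) (Equivalence.to T-≡ fi))

∈-subsetOf⁻ : ∀ {f n} (i : Fin n) → i ∈ subsetOf f n → T (f (toℕ i))
∈-subsetOf⁻ {f} i i∈ = Equivalence.from T-≡ (trans (sym (lookup∘tabulate (f ∘ toℕ) i)) ([]=⇒lookup i∈))

∣subsetOf∣ : ∀ f n → ∣ subsetOf f n ∣ ≡ count f n
∣subsetOf∣ f zero    = refl
∣subsetOf∣ f (suc n) with f 0
... | true  = cong suc (∣subsetOf∣ (f ∘ suc) n)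
... | false = ∣subsetOf∣ (f ∘ suc) n

least-witness : ∀ (P : ℕ → Set) → Decidable P → ∀ {c} → P c →
  Σ ℕ λ k → P k × (∀ m → P m → k ≤ m)
least-witness P P? {c} Pc with search (suc c)
  where
  search : ∀ c → (Σ ℕ λ k → P k × (∀ m → P m → k ≤ m)) ⊎ (∀ m → m < c → ¬ P m)
  search zero = inj₂ (λ m ())
  search (suc c) with search c
  ... | inj₁ least = inj₁ least
  ... | inj₂ none-below with P? c
  ...   | yes Pc = inj₁ (c , Pc , λ m Pm → ≮⇒≥ (λ m<c → none-below m m<c Pm))
  ...   | no ¬Pc = inj₂ (λ m m<1+c → [ (λ m<c → none-below m m<c) , (λ { refl → ¬Pc }) ]
                                       (m<1+n⇒m<n∨m≡n m<1+c))
... | inj₁ least     = least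
... | inj₂ none-upto = contradiction Pc (none-upto c ≤-refl)

Adj? : ∀ n a b → Dec (Adj n a b)
Adj? n a b = ¬? (a Fin.≟ b) ×-dec (gcd ∣ toℕ a - toℕ b ∣ n ≟ 1)

maximalIndependent? : ∀ n S → Dec (MaximalIndependent n S)
maximalIndependent? n S =
  Fin.all? (λ a → Fin.all? λ b → (a ∈? S) →-dec ((b ∈? S) →-dec ¬? (Adj? n a b)))
  ×-dec Fin.all? (λ v → ¬? (v ∈? S) →-dec Fin.any? (λ u → (u ∈? S) ×-dec Adj? n v u))

indepDomNumber≤ : ∀ n (S : Subset n) → MaximalIndependent n S →
  Σ ℕ λ k → IsIndepDomNumber n k × k ≤ ∣ S ∣
indepDomNumber≤ n S S-max with least-witness (λ m → Σ (Subset n) λ T → MaximalIndependent n T × ∣ T ∣ ≡ m)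
    (λ m → anySubset? (λ T → maximalIndependent? n T ×-dec (∣ T ∣ ≟ m))) (S , S-max , refl)
... | k , attained , minimal =
  k , (attained , λ T T-max → minimal ∣ T ∣ (T , T-max , refl)) , minimal ∣ S ∣ (S , S-max , refl)

-- The even-weight binary code of length 3: codewords (x, y, x xor y).
data Coord : Set where
  c₁ c₂ c₃ : Coord

Code : Set
Code = Bool × Bool

bit : Code → Coord → Bool
bit (x , y) c₁ = x
bit (x , y) c₂ = y
bit (x , y) c₃ = x xor y

codewords : List Code
codewords = (false , false) ∷ (false , true) ∷ (true , false) ∷ (true , true) ∷ []

codewords-complete : ∀ c → c LM.∈ codewords
codewords-complete (false , false) = here refl
codewords-complete (false , true)  = there (here refl)
codewords-complete (true  , false) = there (there (here refl))
codewords-complete (true  , true)  = there (there (there (here refl)))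

code-agree : ∀ c d → Σ Coord λ k → bit c k ≡ bit d k
code-agree (x , y) (x′ , y′) with x Bool.≟ x′ | y Bool.≟ y′
... | yes x≡x′ | _        = c₁ , x≡x′
... | no _     | yes y≡y′ = c₂ , y≡y′
... | no x≢x′  | no y≢y′  = c₃ , (begin
  x xor y           ≡⟨ cong₂ _xor_ (¬-not x≢x′) (¬-not y≢y′) ⟩
  not x′ xor not y′ ≡⟨ xor-annihilates-not x′ y′ ⟩
  x′ xor y′         ∎)
  where open ≡-Reasoning

-- A partial word records, for each coordinate, at most one bit.
word : Maybe Bool → Maybe Bool → Maybe Bool → Coord → Maybe Bool
word m₁ m₂ m₃ c₁ = m₁
word m₁ m₂ m₃ c₂ = m₂
word m₁ m₂ m₃ c₃ = m₃

Matches Avoids : (Coord → Maybe Bool) → Code → Set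
Matches m c = ∀ k → m k ≡ just (bit c k)
Avoids  m c = ∀ k → m k ≢ just (bit c k)

away : Maybe Bool → Bool
away (just b) = not b
away nothing  = false

away-avoids : ∀ m → m ≢ just (away m)
away-avoids (just b) eq = not-¬ refl (just-injective eq)
away-avoids nothing ()

xor-cancelʳ : ∀ a b → (a xor b) xor b ≡ a
xor-cancelʳ a b = trans (xor-assoc a b b) (trans (cong (a xor_) (xor-same b)) (xor-identityʳ a))

xor-cancelˡ : ∀ a b → a xor (a xor b) ≡ b
xor-cancelˡ a b = trans (sym (xor-assoc a a b)) (cong (_xor b) (xor-same a))

cover₃ : ∀ m₁ m₂ m₃ → Σ Code (Matches (word m₁ m₂ m₃)) ⊎ Σ Code (Avoids (word m₁ m₂ m₃))
cover₃ m₁ m₂ nothing =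
  inj₂ ((away m₁ , away m₂) , λ { c₁ → away-avoids m₁ ; c₂ → away-avoids m₂ ; c₃ () })
cover₃ nothing m₂ (just z) =
  inj₂ ((not z xor away m₂ , away m₂) , λ { c₁ () ; c₂ → away-avoids m₂
    ; c₃ eq → not-¬ refl (trans (just-injective eq) (xor-cancelʳ (not z) (away m₂))) })
cover₃ (just x) nothing (just z) =
  inj₂ ((not x , not x xor not z) , λ { c₁ → away-avoids (just x) ; c₂ ()
    ; c₃ eq → not-¬ refl (trans (just-injective eq) (xor-cancelˡ (not x) (not z))) })
cover₃ (just x) (just y) (just z) with z Bool.≟ x xor y
... | yes refl = inj₁ ((x , y) , λ { c₁ → refl ; c₂ → refl ; c₃ → refl })
... | no z≢x⊕y = inj₂ ((not x , not y) , λ { c₁ → away-avoids (just x) ; c₂ → away-avoids (just y)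
    ; c₃ eq → z≢x⊕y (trans (just-injective eq) (xor-annihilates-not x y)) })

word-η : ∀ (m : Coord → Maybe Bool) k → m k ≡ word (m c₁) (m c₂) (m c₃) k
word-η m c₁ = refl
word-η m c₂ = refl
word-η m c₃ = refl

code-cover : ∀ m → Σ Code (Matches m) ⊎ Σ Code (Avoids m)
code-cover m with cover₃ (m c₁) (m c₂) (m c₃)
... | inj₁ (c , match) = inj₁ (c , λ k → trans (word-η m k) (match k))
... | inj₂ (c , avoid) = inj₂ (c , λ k → avoid k ∘ trans (sym (word-η m k)))

letter : (Bool → ℕ) → ℕ → Maybe Bool
letter V r with r ≟ V false | r ≟ V true
... | yes _ | _     = just false
... | no _  | yes _ = just true
... | no _  | no _  = nothing

letter-sound : ∀ V r {b} → letter V r ≡ just b → r ≡ V b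
letter-sound V r eq with r ≟ V false | r ≟ V true | eq
... | yes r≡V₀ | _        | refl = r≡V₀
... | no _     | yes r≡V₁ | refl = r≡V₁

letter-complete : ∀ V r {b} → V false ≢ V true → r ≡ V b → letter V r ≡ just b
letter-complete V r {false} _ r≡V₀ with r ≟ V false
... | yes _   = refl
... | no r≢V₀ = contradiction r≡V₀ r≢V₀
letter-complete V r {true} V₀≢V₁ r≡V₁ with r ≟ V false | r ≟ V true
... | yes r≡V₀ | _       = contradiction (trans (sym r≡V₀) r≡V₁) V₀≢V₁
... | no _     | yes _   = refl
... | no _     | no r≢V₁ = contradiction r≡V₁ r≢V₁

pick : Bool → ℕ → ℕ
pick true  w = w
pick false w = 0

pick-∣ : ∀ {d w} b → d ∣ w → d ∣ pick b w
pick-∣ true  d∣w = d∣w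
pick-∣ false _   = _ ∣0

-- With M = P₁ P₂ P₃ and W_k the product of the two primes other than P_k,
-- the codeword c is realised by g c = Σ_k [c_k] W_k, whose residue modulo P_k is 0 or
-- W_k mod P_k ≠ 0 according to the bit c_k.
module ThreePrimes
  (P₁ P₂ P₃ : ℕ) (P₁-prime : Prime P₁) (P₂-prime : Prime P₂) (P₃-prime : Prime P₃)
  (P₁<P₂ : P₁ < P₂) (P₂<P₃ : P₂ < P₃)
  (rest : List ℕ) (rest-prime : All Prime rest) (rest-unique : Unique rest)
  (rest<P₁ : All (_< P₁) rest)
  where

  P : Coord → ℕ
  P c₁ = P₁
  P c₂ = P₂
  P c₃ = P₃

  P-prime : ∀ k → Prime (P k)
  P-prime c₁ = P₁-prime
  P-prime c₂ = P₂-prime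
  P-prime c₃ = P₃-prime

  instance
    P-nonZero : ∀ {k} → NonZero (P k)
    P-nonZero {k} = prime⇒nonZero (P-prime k)

  top primes : List ℕ
  top    = P₁ ∷ P₂ ∷ P₃ ∷ []
  primes = top ++ rest

  top-prime : All Prime top
  top-prime = P₁-prime ∷ P₂-prime ∷ P₃-prime ∷ []

  primes-prime : All Prime primes
  primes-prime = P₁-prime ∷ P₂-prime ∷ P₃-prime ∷ rest-prime

  P₁≢P₂ : P₁ ≢ P₂
  P₁≢P₂ = <⇒≢ P₁<P₂
  P₂≢P₃ : P₂ ≢ P₃
  P₂≢P₃ = <⇒≢ P₂<P₃
  P₁≢P₃ : P₁ ≢ P₃
  P₁≢P₃ = <⇒≢ (<-trans P₁<P₂ P₂<P₃)

  top-unique : Unique top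
  top-unique = (P₁≢P₂ ∷ P₁≢P₃ ∷ []) ∷ (P₂≢P₃ ∷ []) ∷ [] ∷ []

  -- the primes are listed in increasing order, hence distinct
  primes-unique : Unique primes
  primes-unique = (P₁≢P₂ ∷ P₁≢P₃ ∷ All.map (λ r<P₁ → >⇒≢ r<P₁) rest<P₁)
                ∷ (P₂≢P₃ ∷ All.map (λ r<P₁ → >⇒≢ (<-trans r<P₁ P₁<P₂)) rest<P₁)
                ∷ All.map (λ r<P₁ → >⇒≢ (<-trans r<P₁ (<-trans P₁<P₂ P₂<P₃))) rest<P₁
                ∷ rest-unique

  R M n : ℕ
  R = product rest
  M = product top
  n = product primes

  instance
    M-nonZero : NonZero M
    M-nonZero = productOfPrimes≢0 {top} (P₁-prime ∷ P₂-prime ∷ P₃-prime ∷ [])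
    n-nonZero : NonZero n
    n-nonZero = productOfPrimes≢0 primes-prime

  n≡M*R : n ≡ M * R
  n≡M*R = product-++ top rest

  P∣M : ∀ k → P k ∣ M
  P∣M c₁ = ∈⇒∣product {ns = top} (here refl)
  P∣M c₂ = ∈⇒∣product {ns = top} (there (here refl))
  P∣M c₃ = ∈⇒∣product {ns = top} (there (there (here refl)))

  M∣n : M ∣ n
  M∣n = divides R (trans n≡M*R (*-comm M R))

  P∣n : ∀ k → P k ∣ n
  P∣n k = ∣-trans (P∣M k) M∣n

  W : Coord → ℕ
  W c₁ = P₂ * P₃
  W c₂ = P₁ * P₃
  W c₃ = P₁ * P₂

  P∤W : ∀ k → ¬ P k ∣ W k
  P∤W c₁ = prime∤* P₁-prime (prime∤prime P₁-prime P₂-prime P₁≢P₂) (prime∤prime P₁-prime P₃-prime P₁≢P₃)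
  P∤W c₂ = prime∤* P₂-prime (prime∤prime P₂-prime P₁-prime (P₁≢P₂ ∘ sym)) (prime∤prime P₂-prime P₃-prime P₂≢P₃)
  P∤W c₃ = prime∤* P₃-prime (prime∤prime P₃-prime P₁-prime (P₁≢P₃ ∘ sym)) (prime∤prime P₃-prime P₂-prime (P₂≢P₃ ∘ sym))

  g : Code → ℕ
  g c = pick (bit c c₁) (W c₁) + pick (bit c c₂) (W c₂) + pick (bit c c₃) (W c₃)

  V : Coord → Bool → ℕ
  V k b = pick b (W k) % P k

  V-distinct : ∀ k → V k false ≢ V k true
  V-distinct k 0%P≡W%P = P∤W k (m%n≡0⇒n∣m (W k) (P k)
    (trans (sym 0%P≡W%P) (m<n⇒m%n≡m (>-nonZero⁻¹ (P k)))))

  -- g c carries bit c_k in coordinate k: the other two summands are multiples of P k.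
  g-residue : ∀ c k → g c % P k ≡ V k (bit c k)
  g-residue (x , y) c₁ =
    trans (%-remove-+ʳ (pick x (W c₁) + pick y (W c₂)) {d = P₁} (pick-∣ (x xor y) (m∣m*n P₂)))
          (%-remove-+ʳ (pick x (W c₁)) {d = P₁} (pick-∣ y (m∣m*n P₃)))
  g-residue (x , y) c₂ =
    trans (%-remove-+ʳ (pick x (W c₁) + pick y (W c₂)) {d = P₂} (pick-∣ (x xor y) (n∣m*n P₁)))
          (%-remove-+ˡ (pick y (W c₂)) {d = P₂} (pick-∣ x (m∣m*n P₃)))
  g-residue (x , y) c₃ =
    %-remove-+ˡ (pick (x xor y) (W c₃)) {d = P₃} (∣m∣n⇒∣m+n (pick-∣ x (n∣m*n P₂)) (pick-∣ y (n∣m*n P₁)))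

  crt-unique : ∀ {x y} → (∀ k → x % P k ≡ y % P k) → x % M ≡ y % M
  crt-unique {x} {y} same = ≡modulo⇒%≡% x y M (product-∣ top-prime top-unique
    (congruent c₁ ∷ congruent c₂ ∷ congruent c₃ ∷ []))
    where
    congruent : ∀ k → x ≡ y modulo P k
    congruent k = %≡%⇒≡modulo x y (P k) (same k)

  Member : ℕ → Set
  Member x = Σ Code λ c → x % M ≡ g c % M

  codes : ℕ → Code → Bool
  codes r c = r ≡ᵇ g c % M

  inS : ℕ → Bool
  inS x = any (codes (x % M)) codewords

  member⁺ : ∀ {x} → Member x → T (inS x)
  member⁺ {x} (c , x≡gc) =
    any⁺ (codes (x % M)) (Any.map (λ { refl → ≡⇒≡ᵇ _ _ x≡gc }) (codewords-complete c))

  member⁻ : ∀ {x} → T (inS x) → Member x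
  member⁻ {x} t with Any.satisfied (any⁻ (codes (x % M)) codewords t)
  ... | c , x≡ᵇgc = c , ≡ᵇ⇒≡ _ _ x≡ᵇgc

  S : Subset n
  S = subsetOf inS n

  ∈S⁺ : ∀ a → Member (toℕ a) → a ∈ S
  ∈S⁺ a = ∈-subsetOf⁺ {inS} a ∘ member⁺

  ∈S⁻ : ∀ a → a ∈ S → Member (toℕ a)
  ∈S⁻ a = member⁻ ∘ ∈-subsetOf⁻ {inS} a

  -- Members of S coded by codewords agreeing in coordinate k are congruent modulo P k,
  -- so no two members of S are adjacent.
  independent : Independent n S
  independent a b a∈S b∈S (_ , gcd≡1) with ∈S⁻ a a∈S | ∈S⁻ b b∈S
  ... | c , a≡gc | d , b≡gd with code-agree c d
  ... | k , same = >⇒≢ (prime>1 (P-prime k)) (gcd≡1⇒coprime gcd≡1 (P-divides-distance , P∣n k))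
    where
    P-divides-distance : toℕ a ≡ toℕ b modulo P k
    P-divides-distance = %≡%⇒≡modulo (toℕ a) (toℕ b) (P k) (begin
      toℕ a % P k    ≡⟨ %-reduce {m = M} (P∣M k) a≡gc ⟩
      g c % P k      ≡⟨ g-residue c k ⟩
      V k (bit c k)  ≡⟨ cong (V k) same ⟩
      V k (bit d k)  ≡⟨ g-residue d k ⟨
      g d % P k      ≡⟨ %-reduce {m = M} (P∣M k) b≡gd ⟨
      toℕ b % P k    ∎)
      where open ≡-Reasoning

  -- the primes of R, being smaller than P₁, do not divide M
  rest∤M : All (λ q → ¬ q ∣ M) rest
  rest∤M = All.zipWith q∤M (rest-prime , rest<P₁)
    where
    q∤M : ∀ {q} → Prime q × q < P₁ → ¬ q ∣ M
    q∤M (q-prime , q<P₁) q∣M with factorisationHasAllPrimeFactors q-prime q∣M top-prime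
    ... | here refl                 = <-irrefl refl q<P₁
    ... | there (here refl)         = <-asym q<P₁ P₁<P₂
    ... | there (there (here refl)) = <-asym q<P₁ (<-trans P₁<P₂ P₂<P₃)

  prime-factor : ∀ {p} → Prime p → p ∣ n → (Σ Coord λ k → p ≡ P k) ⊎ p LM.∈ rest
  prime-factor p-prime p∣n with factorisationHasAllPrimeFactors p-prime p∣n primes-prime
  ... | here p≡P₁                    = inj₁ (c₁ , p≡P₁)
  ... | there (here p≡P₂)            = inj₁ (c₂ , p≡P₂)
  ... | there (there (here p≡P₃))    = inj₁ (c₃ , p≡P₃)
  ... | there (there (there p∈rest)) = inj₂ p∈rest

  -- If x differs from g c modulo each P k, then some member of S is coprime in distance
  -- to x: take g c + M y with y chosen by avoid-residues for the primes of R.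
  neighbour : ∀ x c → (∀ k → x % P k ≢ g c % P k) →
    Σ (Fin n) λ u → Member (toℕ u) × Coprime ∣ x - toℕ u ∣ n
  neighbour x c differs with avoid-residues rest rest-prime rest-unique M rest∤M (g c) x
  ... | y , avoids = u , (c , trans (u≡u₀ M∣n) (u₀≡gc ∣-refl)) , no-common-prime⇒coprime no-common
    where
    u₀ : ℕ
    u₀ = g c + M * y
    u : Fin n
    u = fromℕ< (m%n<n u₀ n)
    u≡u₀ : ∀ {d} .{{_ : NonZero d}} → d ∣ n → toℕ u % d ≡ u₀ % d
    u≡u₀ {d} d∣n = trans (cong (_% d) (toℕ-fromℕ< (m%n<n u₀ n))) (m∣n⇒o%n%m≡o%m d n u₀ d∣n)
    u₀≡gc : ∀ {d} .{{_ : NonZero d}} → d ∣ M → u₀ % d ≡ g c % d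
    u₀≡gc {d} d∣M = %-remove-+ʳ (g c) (∣m⇒∣m*n y d∣M)
    no-common : ∀ p → Prime p → p ∣ ∣ x - toℕ u ∣ → p ∣ n → ⊥
    no-common p p-prime p∣dist p∣n with prime-factor p-prime p∣n
    ... | inj₁ (k , refl) = differs k (begin
      x % P k       ≡⟨ ≡modulo⇒%≡% x (toℕ u) (P k) p∣dist ⟩
      toℕ u % P k   ≡⟨ u≡u₀ p∣n ⟩
      u₀ % P k      ≡⟨ u₀≡gc (P∣M k) ⟩
      g c % P k     ∎)
      where open ≡-Reasoning
    ... | inj₂ p∈rest = All.lookup avoids p∈rest (≡modulo-sym {x} {u₀} (≡modulo-trans {x} {toℕ u} {u₀} p∣dist
            (%≡%⇒≡modulo (toℕ u) u₀ p (u≡u₀ p∣n))))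
      where instance _ = prime⇒nonZero p-prime

  -- Every vertex outside S has a neighbour in S: by the covering property either v is
  -- coded by a codeword (so v ∈ S) or v differs from some codeword in every coordinate.
  dominating : ∀ v → v ∉ S → Σ (Fin n) λ u → u ∈ S × Adj n v u
  dominating v v∉S with code-cover (λ k → letter (V k) (toℕ v % P k))
  ... | inj₁ (c , match) = contradiction (∈S⁺ v (c , crt-unique λ k →
          trans (letter-sound (V k) _ (match k)) (sym (g-residue c k)))) v∉S
  ... | inj₂ (c , avoid) with neighbour (toℕ v) c (λ k v≡gc →
          avoid k (letter-complete (V k) _ (V-distinct k) (trans v≡gc (g-residue c k))))
  ... | u , u-member , coprime = u , u∈S , (λ v≡u → v∉S (subst (_∈ S) (sym v≡u) u∈S)) , coprime⇒gcd≡1 coprime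
    where
    u∈S : u ∈ S
    u∈S = ∈S⁺ u u-member

  S-maximal : MaximalIndependent n S
  S-maximal = independent , dominating

  -- S meets each block of M consecutive numbers in at most four points (one per codeword),
  -- and n consists of R such blocks, so |S| ≤ 4R.
  inS-periodic : ∀ x → inS (M + x) ≡ inS x
  inS-periodic x = cong (λ r → any (codes r) codewords) (%-remove-+ˡ x (∣-refl {M}))

  count-one-block : count inS M ≤ 4
  count-one-block = ≤-trans (count-mono M reduce) (count-targets (λ c → g c % M) codewords M)
    where
    reduce : ∀ x → x < M → T (inS x) → T (any (codes x) codewords)
    reduce x x<M = subst (λ r → T (any (codes r) codewords)) (m<n⇒m%n≡m x<M)

  ∣S∣≤4R : ∣ S ∣ ≤ 4 * R
  ∣S∣≤4R = begin
    ∣ S ∣              ≡⟨ ∣subsetOf∣ inS n ⟩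
    count inS n        ≡⟨ cong (count inS) (trans n≡M*R (*-comm M R)) ⟩
    count inS (R * M)  ≡⟨ count-periodic inS M inS-periodic R ⟩
    R * count inS M    ≤⟨ *-monoʳ-≤ R count-one-block ⟩
    R * 4              ≡⟨ *-comm R 4 ⟩
    4 * R              ∎
    where open ≤-Reasoning

  indepDom-bound : Σ ℕ λ k → IsIndepDomNumber n k × k ≤ 4 * R
  indepDom-bound with indepDomNumber≤ n S S-maximal
  ... | k , k-isIndepDom , k≤∣S∣ = k , k-isIndepDom , ≤-trans k≤∣S∣ ∣S∣≤4R

  n-primes : HasExactlyPrimeFactors n (3 + length rest)
  n-primes = primes , primes-unique , refl , λ p →
    (λ p∈primes → All.lookup primes-prime p∈primes , ∈⇒∣product p∈primes) ,
    (λ p-prime p∣n → factorisationHasAllPrimeFactors p-prime p∣n primes-prime)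

  P₃-largest : IsLargestPrimeDivisor P₃ n
  P₃-largest = P₃-prime , P∣n c₃ , below
    where
    below : ∀ q → Prime q → q ∣ n → q ≤ P₃
    below q q-prime q∣n with prime-factor q-prime q∣n
    ... | inj₁ (c₁ , refl) = <⇒≤ (<-trans P₁<P₂ P₂<P₃)
    ... | inj₁ (c₂ , refl) = <⇒≤ P₂<P₃
    ... | inj₁ (c₃ , refl) = ≤-refl
    ... | inj₂ q∈rest      = <⇒≤ (<-trans (All.lookup rest<P₁ q∈rest) (<-trans P₁<P₂ P₂<P₃))

nextPrime : ℕ → ℕ
nextPrime m = proj₁ (prime-above m)

nextPrime-prime : ∀ m → Prime (nextPrime m)
nextPrime-prime m = proj₁ (proj₂ (prime-above m))

<nextPrime : ∀ m → m < nextPrime m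
<nextPrime m = proj₂ (proj₂ (prime-above m))

primesAbove : ℕ → ℕ → List ℕ
primesAbove m zero    = []
primesAbove m (suc k) = nextPrime m ∷ primesAbove (nextPrime m) k

primesAbove-prime : ∀ m k → All Prime (primesAbove m k)
primesAbove-prime m zero    = []
primesAbove-prime m (suc k) = nextPrime-prime m ∷ primesAbove-prime (nextPrime m) k

primesAbove-> : ∀ m k → All (m <_) (primesAbove m k)
primesAbove-> m zero    = []
primesAbove-> m (suc k) = <nextPrime m ∷ All.map (<-trans (<nextPrime m)) (primesAbove-> (nextPrime m) k)

primesAbove-unique : ∀ m k → Unique (primesAbove m k)
primesAbove-unique m zero    = []
primesAbove-unique m (suc k) =
  All.map <⇒≢ (primesAbove-> (nextPrime m) k) ∷ primesAbove-unique (nextPrime m) k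

primesAbove-length : ∀ m k → length (primesAbove m k) ≡ k
primesAbove-length m zero    = refl
primesAbove-length m (suc k) = cong suc (primesAbove-length (nextPrime m) k)

primes<above-product : ∀ {ps m} → All Prime ps → product ps < m → All (_< m) ps
primes<above-product ps-prime Π<m =
  All.tabulate λ p∈ps → ≤-<-trans (∈⇒≤product (All.map prime⇒nonZero ps-prime) p∈ps) Π<m

-- The final estimate: i ≤ 4R and 4b < P₁ give i P₃ b < a (P₁ P₂ P₃ R), as 4b < a P₁ P₂.
ratio-bound : ∀ {i R a b P₁ P₂ P₃} .{{_ : NonZero a}} .{{P₂≢0 : NonZero P₂}} .{{_ : NonZero (R * P₃)}} →
  i ≤ 4 * R → 4 * b < P₁ → i * P₃ * b < a * (P₁ * (P₂ * (P₃ * 1)) * R)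
ratio-bound {i} {R} {a} {b} {P₁} {P₂} {P₃} i≤4R 4b<P₁ = begin-strict
  i * P₃ * b               ≤⟨ *-monoˡ-≤ b (*-monoˡ-≤ P₃ i≤4R) ⟩
  4 * R * P₃ * b           ≡⟨ solve 3 (λ R P₃ b → con 4 :* R :* P₃ :* b := con 4 :* b :* (R :* P₃)) refl R P₃ b ⟩
  4 * b * (R * P₃)         <⟨ *-monoˡ-< (R * P₃) 4b<aP₁P₂ ⟩
  a * (P₁ * P₂) * (R * P₃) ≡⟨ solve 5 (λ a P₁ P₂ P₃ R → a :* (P₁ :* P₂) :* (R :* P₃)
                                 := a :* (P₁ :* (P₂ :* (P₃ :* con 1)) :* R)) refl a P₁ P₂ P₃ R ⟩
  a * (P₁ * (P₂ * (P₃ * 1)) * R) ∎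
  where
  open ≤-Reasoning
  open +-*-Solver
  4b<aP₁P₂ : 4 * b < a * (P₁ * P₂)
  4b<aP₁P₂ = <-≤-trans 4b<P₁ (≤-trans (m≤m*n P₁ P₂) (m≤n*m (P₁ * P₂) a))

corollary4p11 : (t : ℕ) → 3 ≤ t → (a b : ℕ) → 0 < a → 0 < b →
    Σ ℕ λ n → 0 < n × HasExactlyPrimeFactors n t ×
      Σ ℕ λ p → IsLargestPrimeDivisor p n ×
        Σ ℕ λ k → IsIndepDomNumber n k × k * p * b < a * n
corollary4p11 0 () _ _ _ _
corollary4p11 1 (s≤s ()) _ _ _ _
corollary4p11 2 (s≤s (s≤s ())) _ _ _ _
corollary4p11 (suc (suc (suc t′))) _ a b a>0 _ =
  let (i , i-isIndepDom , i≤4R) = indepDom-bound in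
  n , >-nonZero⁻¹ n ,
  subst (HasExactlyPrimeFactors n) (cong (3 +_) (primesAbove-length 0 t′)) n-primes ,
  P₃ , P₃-largest ,
  i , i-isIndepDom ,
  subst (λ m → i * P₃ * b < a * m) (sym n≡M*R)
    (ratio-bound {i} {R} {a} {P₂ = P₂} {{P₂≢0 = P-nonZero {c₂}}} i≤4R (≤-<-trans (m≤n+m (4 * b) R) R+4b<P₁))
  where
  rest : List ℕ
  rest = primesAbove 0 t′
  P₁ P₂ P₃ : ℕ
  P₁ = nextPrime (product rest + 4 * b)
  P₂ = nextPrime P₁
  P₃ = nextPrime P₂

  R+4b<P₁ : product rest + 4 * b < P₁
  R+4b<P₁ = <nextPrime _

  open ThreePrimes P₁ P₂ P₃ (nextPrime-prime _) (nextPrime-prime P₁) (nextPrime-prime P₂)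
    (<nextPrime P₁) (<nextPrime P₂) rest (primesAbove-prime 0 t′) (primesAbove-unique 0 t′)
    (primes<above-product (primesAbove-prime 0 t′) (≤-<-trans (m≤m+n (product rest) (4 * b)) R+4b<P₁))

  instance
    a-nonZero : NonZero a
    a-nonZero = >-nonZero a>0
    R*P₃-nonZero : NonZero (R * P₃)
    R*P₃-nonZero = m*n≢0 R P₃ {{productOfPrimes≢0 (primesAbove-prime 0 t′)}} {{P-nonZero {c₃}}}
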